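{- Let $n\ge 2$. There is a bijection between the set of order ideals of the poset $T_n(\{b,r,g\})$ and the set of tournaments on $n$ vertices.
   Context: Let $T_n$ be the set of triples $(c_1,c_2,c_3)$ of nonnegative integers with $c_1+c_2+c_3\le n-2$, and let $v_r=(1,0,0)$, $v_g=(0,1,0)$, $v_b=(-1,1,0)$. $T_n(\{b,r,g\})$ is the poset on $T_n$ whose order is the reflexive–transitive closure of the relations $p<p+v_x$ for $x\in\{r,g,b\}$ and $p,p+v_x\in T_n$. An order ideal is a down-closed subset (including $\emptyset$). A tournament on $n$ vertices is a directed graph on the labeled vertex set $\{1,\dots,n\}$ with exactly one directed edge between each pair of distinct vertices (the edge $i\to j$ meaning $i$ beats $j$). -}

module Defs where

open import Data.Nat using (ℕ; zero; suc; _+_; _∸_; _≤_)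
open import Data.Fin using (Fin)
open import Data.Bool using (Bool; true; false; not)
open import Data.Product using (Σ; _×_; _,_; proj₁)
open import Data.Sum using (_⊎_)
open import Relation.Binary.PropositionalEquality using (_≡_; _≢_)
open import Relation.Binary.Construct.Closure.ReflexiveTransitive using (Star)
open import Relation.Binary.Bundles using (Setoid)
open import Level using (0ℓ)

record T (n : ℕ) : Set where
  constructor tri
  field
    c₁ c₂ c₃ : ℕ
    bound    : c₁ + c₂ + c₃ ≤ n ∸ 2
open T public

-- Covering relations p < p + v_x, for x ∈ {r, g, b}, both endpoints in T_n.
-- v_r = (1,0,0), v_g = (0,1,0), v_b = (-1,1,0).
data Step {n : ℕ} (p q : T n) : Set where
  step-r : c₁ q ≡ suc (c₁ p) → c₂ q ≡ c₂ p → c₃ q ≡ c₃ p → Step p q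
  step-g : c₁ q ≡ c₁ p → c₂ q ≡ suc (c₂ p) → c₃ q ≡ c₃ p → Step p q
  step-b : c₁ p ≡ suc (c₁ q) → c₂ q ≡ suc (c₂ p) → c₃ q ≡ c₃ p → Step p q

_≼_ : {n : ℕ} → T n → T n → Set
_≼_ = Star Step

IsOrderIdeal : (n : ℕ) → (T n → Bool) → Set
IsOrderIdeal n I = (p q : T n) → q ≼ p → I p ≡ true → I q ≡ true

OrderIdeal : ℕ → Set
OrderIdeal n = Σ (T n → Bool) (IsOrderIdeal n)

OrderIdealSetoid : ℕ → Setoid 0ℓ 0ℓ
OrderIdealSetoid n = record
  { Carrier = OrderIdeal n
  ; _≈_ = λ I J → (p : T n) → proj₁ I p ≡ proj₁ J p
  ; isEquivalence = record
    { refl = λ _ → Relation.Binary.PropositionalEquality.refl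
    ; sym = λ e p → Relation.Binary.PropositionalEquality.sym (e p)
    ; trans = λ e f p → Relation.Binary.PropositionalEquality.trans (e p) (f p) } }

IsTournament : (n : ℕ) → (Fin n → Fin n → Bool) → Set
IsTournament n beats =
  ((i : Fin n) → beats i i ≡ false) ×
  ((i j : Fin n) → i ≢ j → beats j i ≡ not (beats i j))

Tournament : ℕ → Set
Tournament n = Σ (Fin n → Fin n → Bool) (IsTournament n)

TournamentSetoid : ℕ → Setoid 0ℓ 0ℓ
TournamentSetoid n = record
  { Carrier = Tournament n
  ; _≈_ = λ S U → (i j : Fin n) → proj₁ S i j ≡ proj₁ U i j
  ; isEquivalence = record
    { refl = λ _ _ → Relation.Binary.PropositionalEquality.refl
    ; sym = λ e i j → Relation.Binary.PropositionalEquality.sym (e i j)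
    ; trans = λ e f i j → Relation.Binary.PropositionalEquality.trans (e i j) (f i j) } }

-- No step changes c₃, so T_n is a disjoint union of layers, the layer c₃ = c being
-- the triangle a + x < K (K = n − 1 − c) with covers (a, x) < (a + 1, x), (a, x + 1),
-- (a − 1, x + 1).  An order ideal of a layer is a staircase: column a is {x < L a}
-- with L a − L (a + 1) ∈ {0, 1} and L K = 0.  So it is the same thing as the bit
-- sequence b a = L a − L (a + 1) (a < K), recovered by L a = Σ_{a ≤ i < K} b i.
-- Reading the bits of the layer with K = j as "i beats j" (i < j), the layers for
-- j = 1, …, n − 1 together give exactly the edges of a tournament on n vertices.
module Submission where

open import Data.Bool using (Bool; true; false; not)
open import Data.Bool.Properties using (not-involutive; T-≡; ¬-not)
open import Data.Empty using (⊥-elim)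
open import Data.Fin using (Fin; toℕ; fromℕ<)
open import Data.Fin.Properties using (toℕ-fromℕ<; fromℕ<-toℕ; toℕ-injective; toℕ<n)
open import Data.Nat
  using (ℕ; zero; suc; _+_; _∸_; _≤_; _<_; z≤n; s≤s; s≤s⁻¹; z<s; s<s; _<ᵇ_; _≤?_; _<?_)
open import Data.Nat.Properties
open import Data.Product using (_,_; proj₁)
open import Function.Base using (_∘_)
open import Function.Definitions using (Congruent; StrictlyInverseˡ; StrictlyInverseʳ)
open import Function.Bundles using (Bijection; Inverse; Equivalence)
open import Function.Properties.Inverse using (Inverse⇒Bijection)
open import Relation.Binary.Bundles using (Setoid)
open import Relation.Binary.Construct.Closure.ReflexiveTransitive using (ε; _◅_)
open import Relation.Binary.Definitions using (Tri; tri<; tri≈; tri>)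
open import Relation.Binary.PropositionalEquality
open import Relation.Nullary using (¬_; yes; no)

open import Defs

open ≡-Reasoning

true≢false : true ≢ false
true≢false ()

boolToℕ : Bool → ℕ
boolToℕ false = 0
boolToℕ true  = 1

boolToℕ≤1 : ∀ c → boolToℕ c ≤ 1
boolToℕ≤1 false = z≤n
boolToℕ≤1 true  = s≤s z≤n

<⇒<ᵇ≡true : ∀ {m n} → m < n → (m <ᵇ n) ≡ true
<⇒<ᵇ≡true = Equivalence.to T-≡ ∘ <⇒<ᵇ

<ᵇ≡true⇒< : ∀ {m n} → (m <ᵇ n) ≡ true → m < n
<ᵇ≡true⇒< = <ᵇ⇒< _ _ ∘ Equivalence.from T-≡

≮⇒<ᵇ≡false : ∀ {m n} → ¬ m < n → (m <ᵇ n) ≡ false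
≮⇒<ᵇ≡false m≮n = ¬-not (m≮n ∘ <ᵇ≡true⇒<)

<ᵇ-map : ∀ {m n m′ n′} → (m < n → m′ < n′) → (m <ᵇ n) ≡ true → (m′ <ᵇ n′) ≡ true
<ᵇ-map f = <⇒<ᵇ≡true ∘ f ∘ <ᵇ≡true⇒<

n<ᵇboolToℕ+n : ∀ c n → (n <ᵇ boolToℕ c + n) ≡ c
n<ᵇboolToℕ+n false n = ≮⇒<ᵇ≡false (n≮n n)
n<ᵇboolToℕ+n true  n = <⇒<ᵇ≡true (n<1+n n)

n<o∸m⇒m+n<o : ∀ m {n o} → n < o ∸ m → m + n < o
n<o∸m⇒m+n<o zero              n<o   = n<o
n<o∸m⇒m+n<o (suc m) {o = suc o} n<o∸m = s≤s (n<o∸m⇒m+n<o m n<o∸m)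

m+n<o⇒n<o∸m : ∀ m {n o} → m + n < o → n < o ∸ m
m+n<o⇒n<o∸m zero              m+n<o         = m+n<o
m+n<o⇒n<o∸m (suc m) {o = suc o} (s≤s m+n<o) = m+n<o⇒n<o∸m m m+n<o

count : (ℕ → Bool) → ℕ → ℕ
count f zero    = 0
count f (suc k) = boolToℕ (f 0) + count (f ∘ suc) k

count-cong : ∀ {f g} k → (∀ {x} → x < k → f x ≡ g x) → count f k ≡ count g k
count-cong zero    f≗g = refl
count-cong (suc k) f≗g = cong₂ _+_ (cong boolToℕ (f≗g z<s)) (count-cong k (f≗g ∘ s<s))

count-≤ : ∀ f k → count f k ≤ k
count-≤ f zero = z≤n
count-≤ f (suc k) with f 0
... | true  = s≤s (count-≤ (f ∘ suc) k)
... | false = m≤n⇒m≤1+n (count-≤ (f ∘ suc) k)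

count-false : ∀ {f} → (∀ x → f x ≡ false) → ∀ k → count f k ≡ 0
count-false f≡false zero = refl
count-false f≡false (suc k) rewrite f≡false 0 = count-false (f≡false ∘ suc) k

count-<ᵇ : ∀ m k → m ≤ k → count (_<ᵇ m) k ≡ m
count-<ᵇ zero    k       _         = count-false (λ _ → refl) k
count-<ᵇ (suc m) (suc k) (s≤s m≤k) = cong suc (count-<ᵇ m k m≤k)

record DownClosed (f : ℕ → Bool) : Set where
  constructor downClosed
  field
    lower : ∀ {x} → f (suc x) ≡ true → f x ≡ true

downClosed-∘suc : ∀ {f} → DownClosed f → DownClosed (f ∘ suc)
downClosed-∘suc dc = downClosed (DownClosed.lower dc)

downClosed-false : ∀ {f} → DownClosed f → f 0 ≡ false → ∀ x → f x ≡ false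
downClosed-false dc f0 zero    = f0
downClosed-false dc f0 (suc x) =
  ¬-not λ fsx → true≢false (trans (sym (DownClosed.lower dc fsx)) (downClosed-false dc f0 x))

downClosed⇒≡<ᵇcount : ∀ {f} → DownClosed f → ∀ {x} k → x < k → f x ≡ (x <ᵇ count f k)
downClosed⇒≡<ᵇcount {f} dc (suc k) x<k with f 0 in f0
... | false = trans (downClosed-false dc f0 _)
                    (cong (_ <ᵇ_) (sym (count-false (downClosed-false dc f0 ∘ suc) k)))
downClosed⇒≡<ᵇcount dc {zero}  (suc k) _         | true = f0
downClosed⇒≡<ᵇcount dc {suc x} (suc k) (s≤s x<k) | true =
  downClosed⇒≡<ᵇcount (downClosed-∘suc dc) k x<k

-- Applied to the columns f = a and g = a + 1 of a layer ideal: column a is higher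
-- than column a + 1 exactly when it contains the cell at the height of column a + 1.
count-interleave : ∀ {f g} → DownClosed f → DownClosed g →
                   (∀ {x} → g x ≡ true → f x ≡ true) →
                   (∀ {x} → f (suc x) ≡ true → g x ≡ true) →
                   ∀ k → count f (suc k) ≡ boolToℕ (f (count g k)) + count g k
count-interleave df dg g⊆f f⊆g zero = refl
count-interleave {f} {g} df dg g⊆f f⊆g (suc k) with g 0 in g0
... | true rewrite g⊆f g0 =
  trans (cong suc (count-interleave (downClosed-∘suc df) (downClosed-∘suc dg) g⊆f f⊆g k))
        (sym (+-suc _ _))
... | false = begin
    boolToℕ (f 0) + count (f ∘ suc) (suc k)   ≡⟨ cong (boolToℕ (f 0) +_) f∘suc-empty ⟩
    boolToℕ (f 0) + 0                         ≡⟨ cong (λ m → boolToℕ (f m) + m) g∘suc-empty ⟨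
    boolToℕ (f (count (g ∘ suc) k)) + count (g ∘ suc) k ∎
  where
  g∘suc-empty : count (g ∘ suc) k ≡ 0
  g∘suc-empty = count-false (downClosed-false dg g0 ∘ suc) k
  f∘suc-empty : count (f ∘ suc) (suc k) ≡ 0
  f∘suc-empty = count-false (downClosed-false (downClosed-∘suc df) f1≡false) (suc k)
    where
    f1≡false : f 1 ≡ false
    f1≡false = ¬-not λ f1 → true≢false (trans (sym (f⊆g f1)) g0)

suffixCount : (ℕ → Bool) → ℕ → ℕ → ℕ
suffixCount b K e = count (b ∘ (e +_)) (K ∸ e)

suffixCount-≤ : ∀ b K e → suffixCount b K e ≤ K ∸ e
suffixCount-≤ b K e = count-≤ (b ∘ (e +_)) (K ∸ e)

suffixCount-cong : ∀ {b b′} K e → (∀ {i} → i < K → b i ≡ b′ i) →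
                   suffixCount b K e ≡ suffixCount b′ K e
suffixCount-cong K e b≗b′ = count-cong (K ∸ e) (b≗b′ ∘ n<o∸m⇒m+n<o e)

suffixCount-< : ∀ b {K e} → e < K → suffixCount b K e ≡ boolToℕ (b e) + suffixCount b K (suc e)
suffixCount-< b {K} {e} e<K rewrite +-∸-assoc 1 e<K =
  cong₂ _+_ (cong (boolToℕ ∘ b) (+-identityʳ e))
            (count-cong (K ∸ suc e) λ {x} _ → cong b (+-suc e x))

suffixCount-≥ : ∀ b {K e} → K ≤ e → suffixCount b K e ≡ 0
suffixCount-≥ b K≤e rewrite m≤n⇒m∸n≡0 K≤e = refl

suffixCount-suc-≤ : ∀ b K e → suffixCount b K (suc e) ≤ suffixCount b K e
suffixCount-suc-≤ b K e with e <? K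
... | yes e<K rewrite suffixCount-< b e<K = m≤n+m _ (boolToℕ (b e))
... | no  e≮K rewrite suffixCount-≥ b (m≤n⇒m≤1+n (≮⇒≥ e≮K)) = z≤n

suffixCount-≤-suc : ∀ b K e → suffixCount b K e ≤ suc (suffixCount b K (suc e))
suffixCount-≤-suc b K e with e <? K
... | yes e<K rewrite suffixCount-< b e<K = +-monoˡ-≤ _ (boolToℕ≤1 (b e))
... | no  e≮K rewrite suffixCount-≥ b (≮⇒≥ e≮K) = z≤n

-- A down-closed predicate on one layer of T_n, with (a, x) = (c₁, c₂), one field per
-- step g, r, b.  Layers are extended by false outside their triangle, so no bounds appear.
record IsLayerIdeal (h : ℕ → ℕ → Bool) : Set where
  field
    down-g : ∀ {a x} → h a (suc x) ≡ true → h a x ≡ true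
    down-r : ∀ {a x} → h (suc a) x ≡ true → h a x ≡ true
    down-b : ∀ {a x} → h a (suc x) ≡ true → h (suc a) x ≡ true

module Layer (K : ℕ) where

  height : (ℕ → ℕ → Bool) → ℕ → ℕ
  height h a = count (h a) (K ∸ a)

  bitsOf : (ℕ → ℕ → Bool) → ℕ → Bool
  bitsOf h a = h a (height h (suc a))

  staircase : (ℕ → Bool) → ℕ → ℕ → Bool
  staircase b a x = x <ᵇ suffixCount b K a

  staircase-isLayerIdeal : ∀ b → IsLayerIdeal (staircase b)
  staircase-isLayerIdeal b = record
    { down-g = λ {a} {x} → <ᵇ-map {suc x} {S a} (<-trans (n<1+n x))
    ; down-r = λ {a} {x} → <ᵇ-map {x} {S (suc a)} (λ lt → <-≤-trans lt (suffixCount-suc-≤ b K a))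
    ; down-b = λ {a} {x} → <ᵇ-map {suc x} {S a} λ lt →
                 s≤s⁻¹ (≤-trans lt (suffixCount-≤-suc b K a))
    }
    where
    S : ℕ → ℕ
    S = suffixCount b K

  staircase-cong : ∀ {b b′} → (∀ {i} → i < K → b i ≡ b′ i) →
                   ∀ a x → staircase b a x ≡ staircase b′ a x
  staircase-cong b≗b′ a x = cong (x <ᵇ_) (suffixCount-cong K a b≗b′)

  bitsOf-staircase : ∀ b {a} → a < K → bitsOf (staircase b) a ≡ b a
  bitsOf-staircase b {a} a<K = begin
    staircase b a (height (staircase b) (suc a))
      ≡⟨ cong (staircase b a) (count-<ᵇ _ _ (suffixCount-≤ b K (suc a))) ⟩
    suffixCount b K (suc a) <ᵇ suffixCount b K a
      ≡⟨ cong (suffixCount b K (suc a) <ᵇ_) (suffixCount-< b a<K) ⟩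
    suffixCount b K (suc a) <ᵇ boolToℕ (b a) + suffixCount b K (suc a)
      ≡⟨ n<ᵇboolToℕ+n (b a) _ ⟩
    b a ∎

  module _ {h : ℕ → ℕ → Bool} (layer : IsLayerIdeal h) where
    open IsLayerIdeal layer

    suffixCount-bitsOf : ∀ d {a} → d + a ≡ K → suffixCount (bitsOf h) K a ≡ height h a
    suffixCount-bitsOf zero {a} refl rewrite n∸n≡0 a = refl
    suffixCount-bitsOf (suc d) {a} d+a≡K = begin
      suffixCount (bitsOf h) K a
        ≡⟨ suffixCount-< (bitsOf h) a<K ⟩
      boolToℕ (bitsOf h a) + suffixCount (bitsOf h) K (suc a)
        ≡⟨ cong (boolToℕ (bitsOf h a) +_) (suffixCount-bitsOf d (trans (+-suc d a) d+a≡K)) ⟩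
      boolToℕ (h a (height h (suc a))) + height h (suc a)
        ≡⟨ count-interleave (downClosed down-g) (downClosed down-g) down-r down-b (K ∸ suc a) ⟨
      count (h a) (suc (K ∸ suc a))
        ≡⟨ cong (count (h a)) (+-∸-assoc 1 a<K) ⟨
      height h a ∎
      where
      a<K : a < K
      a<K = subst (a <_) d+a≡K (s≤s (m≤n+m a d))

    staircase-bitsOf : ∀ a x → a + x < K → staircase (bitsOf h) a x ≡ h a x
    staircase-bitsOf a x a+x<K = begin
      x <ᵇ suffixCount (bitsOf h) K a
        ≡⟨ cong (x <ᵇ_) (suffixCount-bitsOf (K ∸ a) (m∸n+n≡m a≤K)) ⟩
      x <ᵇ height h a
        ≡⟨ downClosed⇒≡<ᵇcount (downClosed down-g) (K ∸ a) (m+n<o⇒n<o∸m a a+x<K) ⟨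
      h a x ∎
      where
      a≤K : a ≤ K
      a≤K = ≤-trans (m≤m+n a x) (<⇒≤ a+x<K)

  bitsOf-cong : ∀ {h h′} → (∀ a x → a + x < K → h a x ≡ h′ a x) →
                ∀ {a} → a < K → bitsOf h a ≡ bitsOf h′ a
  bitsOf-cong {h} {h′} h≗h′ {a} a<K = begin
    h a (height h (suc a))
      ≡⟨ cong (h a) (count-cong (K ∸ suc a) λ {x} → h≗h′ (suc a) x ∘ n<o∸m⇒m+n<o (suc a)) ⟩
    h a (height h′ (suc a))
      ≡⟨ h≗h′ a _ (n<o∸m⇒m+n<o a height<) ⟩
    h′ a (height h′ (suc a)) ∎
    where
    height< : height h′ (suc a) < K ∸ a
    height< = subst (height h′ (suc a) <_) (sym (+-∸-assoc 1 a<K))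
                    (s≤s (count-≤ (h′ (suc a)) (K ∸ suc a)))

module _ {m : ℕ} where

  adjacency : (Fin m → Fin m → Bool) → ℕ → ℕ → Bool
  adjacency t i j with i <? m | j <? m
  ... | yes i<m | yes j<m = t (fromℕ< i<m) (fromℕ< j<m)
  ... | _       | _       = false

  adjacency-toℕ : ∀ t (i j : Fin m) → adjacency t (toℕ i) (toℕ j) ≡ t i j
  adjacency-toℕ t i j with toℕ i <? m | toℕ j <? m
  ... | yes i<m | yes j<m = cong₂ t (fromℕ<-toℕ i i<m) (fromℕ<-toℕ j j<m)
  ... | no  i≮m | _       = ⊥-elim (i≮m (toℕ<n i))
  ... | yes _   | no  j≮m = ⊥-elim (j≮m (toℕ<n j))

  adjacency-cong : ∀ {t t′} → (∀ i j → t i j ≡ t′ i j) → ∀ i j → adjacency t i j ≡ adjacency t′ i j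
  adjacency-cong t≗t′ i j with i <? m | j <? m
  ... | yes _ | yes _ = t≗t′ _ _
  ... | yes _ | no  _ = refl
  ... | no  _ | _     = refl

  orient : (ℕ → ℕ → Bool) → Fin m → Fin m → Bool
  orient u i j with <-cmp (toℕ i) (toℕ j)
  ... | tri< _ _ _ = u (toℕ i) (toℕ j)
  ... | tri≈ _ _ _ = false
  ... | tri> _ _ _ = not (u (toℕ j) (toℕ i))

  orient-< : ∀ u i j → toℕ i < toℕ j → orient u i j ≡ u (toℕ i) (toℕ j)
  orient-< u i j i<j with <-cmp (toℕ i) (toℕ j)
  ... | tri< _ _ _   = refl
  ... | tri≈ _ i≡j _ = ⊥-elim (<-irrefl i≡j i<j)
  ... | tri> _ _ j<i = ⊥-elim (<-asym i<j j<i)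

  orient-> : ∀ u i j → toℕ j < toℕ i → orient u i j ≡ not (u (toℕ j) (toℕ i))
  orient-> u i j j<i with <-cmp (toℕ i) (toℕ j)
  ... | tri< i<j _ _ = ⊥-elim (<-asym i<j j<i)
  ... | tri≈ _ i≡j _ = ⊥-elim (<-irrefl (sym i≡j) j<i)
  ... | tri> _ _ _   = refl

  orient-≡ : ∀ u i j → toℕ i ≡ toℕ j → orient u i j ≡ false
  orient-≡ u i j i≡j with <-cmp (toℕ i) (toℕ j)
  ... | tri< i<j _ _ = ⊥-elim (<-irrefl i≡j i<j)
  ... | tri≈ _ _ _   = refl
  ... | tri> _ _ j<i = ⊥-elim (<-irrefl (sym i≡j) j<i)

  orient-isTournament : ∀ u → IsTournament m (orient u)
  orient-isTournament u =
    (λ i → orient-≡ u i i refl) , λ i j i≢j → antisymmetric i j i≢j (<-cmp (toℕ i) (toℕ j))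
    where
    antisymmetric : ∀ i j → i ≢ j → Tri (toℕ i < toℕ j) (toℕ i ≡ toℕ j) (toℕ j < toℕ i) →
                    orient u j i ≡ not (orient u i j)
    antisymmetric i j _ (tri< i<j _ _) =
      trans (orient-> u j i i<j) (cong not (sym (orient-< u i j i<j)))
    antisymmetric i j i≢j (tri≈ _ i≡j _) = ⊥-elim (i≢j (toℕ-injective i≡j))
    antisymmetric i j _ (tri> _ _ j<i) = begin
      orient u j i                  ≡⟨ orient-< u j i j<i ⟩
      u (toℕ j) (toℕ i)             ≡⟨ not-involutive _ ⟨
      not (not (u (toℕ j) (toℕ i))) ≡⟨ cong not (orient-> u i j j<i) ⟨
      not (orient u i j)            ∎

  orient-cong : ∀ {u u′} → (∀ i j → toℕ i < toℕ j → u (toℕ i) (toℕ j) ≡ u′ (toℕ i) (toℕ j)) →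
                ∀ i j → orient u i j ≡ orient u′ i j
  orient-cong {u} {u′} u≗u′ i j = by-cases (<-cmp (toℕ i) (toℕ j))
    where
    by-cases : Tri (toℕ i < toℕ j) (toℕ i ≡ toℕ j) (toℕ j < toℕ i) → orient u i j ≡ orient u′ i j
    by-cases (tri< i<j _ _) =
      trans (orient-< u i j i<j) (trans (u≗u′ i j i<j) (sym (orient-< u′ i j i<j)))
    by-cases (tri≈ _ i≡j _) = trans (orient-≡ u i j i≡j) (sym (orient-≡ u′ i j i≡j))
    by-cases (tri> _ _ j<i) =
      trans (orient-> u i j j<i) (trans (cong not (u≗u′ j i j<i)) (sym (orient-> u′ i j j<i)))

  orient-unique : ∀ {u} (t : Tournament m) →
                  (∀ i j → toℕ i < toℕ j → u (toℕ i) (toℕ j) ≡ proj₁ t i j) →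
                  ∀ i j → orient u i j ≡ proj₁ t i j
  orient-unique {u} (t , irreflexive , antisymmetric) u≗t i j = by-cases (<-cmp (toℕ i) (toℕ j))
    where
    by-cases : Tri (toℕ i < toℕ j) (toℕ i ≡ toℕ j) (toℕ j < toℕ i) → orient u i j ≡ t i j
    by-cases (tri< i<j _ _) = trans (orient-< u i j i<j) (u≗t i j i<j)
    by-cases (tri≈ _ i≡j _) =
      trans (orient-≡ u i j i≡j)
            (subst (λ k → false ≡ t i k) (toℕ-injective i≡j) (sym (irreflexive i)))
    by-cases (tri> _ _ j<i) =
      trans (orient-> u i j j<i) (trans (cong not (u≗t j i j<i))
            (sym (antisymmetric j i λ j≡i → <-irrefl (cong toℕ j≡i) j<i)))

  adjacency-orient : ∀ u {i j} → i < j → j < m → adjacency (orient u) i j ≡ u i j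
  adjacency-orient u {i} {j} i<j j<m with i <? m | j <? m
  ... | yes i<m | yes j<m′ = begin
    orient u (fromℕ< i<m) (fromℕ< j<m′)
      ≡⟨ orient-< u _ _ (subst₂ _<_ (sym (toℕ-fromℕ< i<m)) (sym (toℕ-fromℕ< j<m′)) i<j) ⟩
    u (toℕ (fromℕ< i<m)) (toℕ (fromℕ< j<m′))
      ≡⟨ cong₂ u (toℕ-fromℕ< i<m) (toℕ-fromℕ< j<m′) ⟩
    u i j ∎
  ... | no  i≮m | _        = ⊥-elim (i≮m (<-trans i<j j<m))
  ... | yes _   | no  j≮m  = ⊥-elim (j≮m j<m)

module OrderIdealsAndTournaments (N : ℕ) where
  open Layer

  n : ℕ
  n = suc (suc N)

  -- Layer c of T_n is the triangle a + x < width c.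
  width : ℕ → ℕ
  width c = suc (N ∸ c)

  width-bound : ∀ {a x c} → c ≤ N → a + x < width c → a + x + c ≤ N
  width-bound {a} {x} c≤N a+x<K = m≤o∸n⇒m+n≤o (a + x) c≤N (s≤s⁻¹ a+x<K)

  -- Vertex j ≥ 1 corresponds to the layer of width j.
  layerOfVertex : ℕ → ℕ
  layerOfVertex j = suc N ∸ j

  width-layerOfVertex : ∀ {i j} → i < j → j < n → width (layerOfVertex j) ≡ j
  width-layerOfVertex {j = suc j} _ (s≤s (s≤s j≤N)) = cong suc (m∸[m∸n]≡n j≤N)

  layerOfVertex-≤ : ∀ {i j} → i < j → layerOfVertex j ≤ N
  layerOfVertex-≤ {j = suc j} _ = m∸n≤m N j

  layerOfVertex-width : ∀ {c} → c ≤ N → layerOfVertex (width c) ≡ c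
  layerOfVertex-width = m∸[m∸n]≡n

  extend : (T n → Bool) → ℕ → ℕ → ℕ → Bool
  extend I a x c with a + x + c ≤? N
  ... | yes p = I (tri a x c p)
  ... | no  _ = false

  extend-inside : ∀ I a x c (p : a + x + c ≤ N) → extend I a x c ≡ I (tri a x c p)
  extend-inside I a x c p with a + x + c ≤? N
  ... | yes p′ = cong (I ∘ tri a x c) (≤-irrelevant p′ p)
  ... | no  p̸ = ⊥-elim (p̸ p)

  extend-cong : ∀ {I J} → (∀ p → I p ≡ J p) → ∀ a x c → extend I a x c ≡ extend J a x c
  extend-cong I≗J a x c with a + x + c ≤? N
  ... | yes _ = I≗J _
  ... | no  _ = refl

  extend-lower : ∀ {I} → IsOrderIdeal n I → ∀ a x a′ x′ c →
                 (a′ + x′ + c ≤ N → a + x + c ≤ N) →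
                 (∀ {p p′} → Step {n} (tri a x c p) (tri a′ x′ c p′)) →
                 extend I a′ x′ c ≡ true → extend I a x c ≡ true
  extend-lower {I} ideal a x a′ x′ c bound step h with a′ + x′ + c ≤? N
  ... | yes p′ = trans (extend-inside I a x c (bound p′)) (ideal _ _ (step ◅ ε) h)
  ... | no  _  = ⊥-elim (true≢false (sym h))

  layerOf : (T n → Bool) → ℕ → ℕ → ℕ → Bool
  layerOf I c a x = extend I a x c

  layerOf-isLayerIdeal : ∀ {I} → IsOrderIdeal n I → ∀ c → IsLayerIdeal (layerOf I c)
  layerOf-isLayerIdeal ideal c = record
    { down-g = λ {a} {x} → extend-lower ideal a x a (suc x) c
        (≤-trans (+-monoˡ-≤ c (+-monoʳ-≤ a (n≤1+n x)))) (step-g refl refl refl)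
    ; down-r = λ {a} {x} → extend-lower ideal a x (suc a) x c
        (≤-trans (n≤1+n _)) (step-r refl refl refl)
    ; down-b = λ {a} {x} → extend-lower ideal (suc a) x a (suc x) c
        (subst (_≤ N) (cong (_+ c) (+-suc a x))) (step-b refl refl refl)
    }

  column : (Fin n → Fin n → Bool) → ℕ → ℕ → Bool
  column t j i = adjacency t i j

  idealOf : (Fin n → Fin n → Bool) → T n → Bool
  idealOf t (tri a x c _) = staircase (width c) (column t (width c)) a x

  idealOf-step : ∀ t {p q} → Step p q → idealOf t q ≡ true → idealOf t p ≡ true
  idealOf-step t {tri a x c _} {tri _ _ _ _} (step-r refl refl refl) = down-r {a} {x}
    where open IsLayerIdeal (staircase-isLayerIdeal (width c) (column t (width c)))
  idealOf-step t {tri a x c _} {tri _ _ _ _} (step-g refl refl refl) = down-g {a} {x}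
    where open IsLayerIdeal (staircase-isLayerIdeal (width c) (column t (width c)))
  idealOf-step t {tri _ x c _} {tri a _ _ _} (step-b refl refl refl) = down-b {a} {x}
    where open IsLayerIdeal (staircase-isLayerIdeal (width c) (column t (width c)))

  idealOf-isOrderIdeal : ∀ t → IsOrderIdeal n (idealOf t)
  idealOf-isOrderIdeal t p q ε               h = h
  idealOf-isOrderIdeal t p q (step ◅ steps) h =
    idealOf-step t step (idealOf-isOrderIdeal t p _ steps h)

  upper : (T n → Bool) → ℕ → ℕ → Bool
  upper I i j = bitsOf (width c) (layerOf I c) i
    where
    c = layerOfVertex j

  upper-cong : ∀ {I J} → (∀ p → I p ≡ J p) → ∀ {i j} → i < j → j < n → upper I i j ≡ upper J i j
  upper-cong I≗J {i} {j} i<j j<n =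
    bitsOf-cong (width c) (λ a x _ → extend-cong I≗J a x c)
                (subst (i <_) (sym (width-layerOfVertex i<j j<n)) i<j)
    where
    c = layerOfVertex j

  layerOf-idealOf : ∀ t {c} → c ≤ N → ∀ a x → a + x < width c →
                    layerOf (idealOf t) c a x ≡ staircase (width c) (column t (width c)) a x
  layerOf-idealOf t {c} c≤N a x a+x<K =
    extend-inside (idealOf t) a x c (width-bound {a} {x} c≤N a+x<K)

  upper-idealOf : ∀ t {i j} → i < j → j < n → upper (idealOf t) i j ≡ adjacency t i j
  upper-idealOf t {i} {j} i<j j<n = begin
    bitsOf K (layerOf (idealOf t) c) i  ≡⟨ bitsOf-cong K (layerOf-idealOf t c≤N) i<K ⟩
    bitsOf K (staircase K (column t K)) i ≡⟨ bitsOf-staircase K (column t K) i<K ⟩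
    adjacency t i K                     ≡⟨ cong (adjacency t i) K≡j ⟩
    adjacency t i j                     ∎
    where
    c = layerOfVertex j
    K = width c
    K≡j : K ≡ j
    K≡j = width-layerOfVertex i<j j<n
    i<K : i < K
    i<K = subst (i <_) (sym K≡j) i<j
    c≤N : c ≤ N
    c≤N = layerOfVertex-≤ i<j

  column-orient-upper : ∀ I {c i} → c ≤ N → i < width c →
                        column (orient (upper I)) (width c) i ≡ bitsOf (width c) (layerOf I c) i
  column-orient-upper I {c} {i} c≤N i<K = begin
    column (orient (upper I)) (width c) i
      ≡⟨ adjacency-orient {n} (upper I) i<K (s≤s (s≤s (m∸n≤m N c))) ⟩
    upper I i (width c)
      ≡⟨ cong (λ c′ → bitsOf (width c′) (layerOf I c′) i) (layerOfVertex-width c≤N) ⟩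
    bitsOf (width c) (layerOf I c) i ∎

  open Setoid (OrderIdealSetoid n) using () renaming (_≈_ to _≈ᴵ_)
  open Setoid (TournamentSetoid n) using () renaming (_≈_ to _≈ᵀ_)

  tournamentOf : OrderIdeal n → Tournament n
  tournamentOf (I , _) = orient (upper I) , orient-isTournament (upper I)

  orderIdealOf : Tournament n → OrderIdeal n
  orderIdealOf (t , _) = idealOf t , idealOf-isOrderIdeal t

  tournamentOf-cong : Congruent _≈ᴵ_ _≈ᵀ_ tournamentOf
  tournamentOf-cong {I , _} {J , _} I≗J = orient-cong λ i j i<j → upper-cong I≗J i<j (toℕ<n j)

  orderIdealOf-cong : Congruent _≈ᵀ_ _≈ᴵ_ orderIdealOf
  orderIdealOf-cong t≗t′ (tri a x c _) =
    staircase-cong (width c) (λ {i} _ → adjacency-cong t≗t′ i (width c)) a x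

  tournamentOf-orderIdealOf : StrictlyInverseˡ _≈ᵀ_ tournamentOf orderIdealOf
  tournamentOf-orderIdealOf t = orient-unique t λ i j i<j →
    trans (upper-idealOf (proj₁ t) i<j (toℕ<n j)) (adjacency-toℕ (proj₁ t) i j)

  orderIdealOf-tournamentOf : StrictlyInverseʳ _≈ᴵ_ tournamentOf orderIdealOf
  orderIdealOf-tournamentOf (I , ideal) (tri a x c bound) = begin
    staircase K (column (orient (upper I)) K) a x
      ≡⟨ staircase-cong K (column-orient-upper I c≤N) a x ⟩
    staircase K (bitsOf K (layerOf I c)) a x
      ≡⟨ staircase-bitsOf K (layerOf-isLayerIdeal ideal c) a x a+x<K ⟩
    extend I a x c
      ≡⟨ extend-inside I a x c bound ⟩
    I (tri a x c bound) ∎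
    where
    K = width c
    c≤N : c ≤ N
    c≤N = ≤-trans (m≤n+m c (a + x)) bound
    a+x<K : a + x < K
    a+x<K = s≤s (m+n≤o⇒m≤o∸n (a + x) bound)

  -- The setoid relations unfold to pointwise equalities, from which unification
  -- cannot recover implicit arguments; hence the explicit ones below.
  inverse : Inverse (OrderIdealSetoid n) (TournamentSetoid n)
  inverse = record
    { to        = tournamentOf
    ; from      = orderIdealOf
    ; to-cong   = λ {I} {J} → tournamentOf-cong {I} {J}
    ; from-cong = λ {t} {t′} → orderIdealOf-cong {t} {t′}
    ; inverse   = (λ {t} {I} I≈t i j → trans (tournamentOf-cong {I} {orderIdealOf t} I≈t i j)
                                             (tournamentOf-orderIdealOf t i j))
                , (λ {I} {t} t≈I p → trans (orderIdealOf-cong {t} {tournamentOf I} t≈I p)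
                                           (orderIdealOf-tournamentOf I p))
    }

theorem15 : (n : ℕ) → 2 ≤ n → Bijection (OrderIdealSetoid n) (TournamentSetoid n)
theorem15 (suc zero)    (s≤s ())
theorem15 (suc (suc N)) _ = Inverse⇒Bijection (OrderIdealsAndTournaments.inverse N)
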